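{- For every nondeterministic Büchi automaton $\mathcal{A}=\langle Q,\iota,\Sigma,\delta,\alpha\rangle$, the pre-order $\preceq_{\sf univ}$ is a simulation for the nondeterministic Büchi automaton ${\sf KVMH}(\mathcal{A})$ (with $k=2(|Q|-|\alpha|)$).
   Context: An NBW is $\mathcal{A}=\langle Q,\iota,\Sigma,\delta,\alpha\rangle$ with finite state set $Q$, initial state $\iota$, finite alphabet $\Sigma$, $\delta:Q\times\Sigma\to 2^Q$, accepting set $\alpha\subseteq Q$. For even $k$, let $[k]=\{0,1,\dots,k\}$, $Q_k = 2^{(Q\times[k])\setminus(\alpha\times\mathbb{N}^{odd})}$ (where $\mathbb{N}^{odd}$ is the set of odd naturals), and $\mathsf{odd}=Q\times[k]^{odd}$. ${\sf KVMH}(\mathcal{A},k)$ is the NBW with states $Q_k\times Q_k$, initial state $(\{(\iota,k)\},\emptyset)$, accepting states $Q_k\times\{\emptyset\}$, and transitions: if $o\neq\emptyset$, $\delta'(\langle s,o\rangle,\sigma)$ is the set of pairs $\langle s',o'\setminus\mathsf{odd}\rangle$ (with $s',o'\in Q_k$) such that (i) $o'\subseteq s'$; (ii) for all $(\ell,n)\in s$ and $\ell'\in\delta(\ell,\sigma)$ there is $n'\le n$ with $(\ell',n')\in s'$; (iii) for all $(\ell,n)\in o$ and $\ell'\in\delta(\ell,\sigma)$ there is $n'\le n$ with $(\ell',n')\in o'$. If $o=\emptyset$, $\delta'(\langle s,o\rangle,\sigma)$ is the set of pairs $\langle s',s'\setminus\mathsf{odd}\rangle$ such that for all $(\ell,n)\in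 s$ and $\ell'\in\delta(\ell,\sigma)$ there is $n'\le n$ with $(\ell',n')\in s'$. ${\sf KVMH}(\mathcal{A})$ denotes ${\sf KVMH}(\mathcal{A},2(|Q|-|\alpha|))$, with state set written $Q_k\times Q_k$. The pre-order $\preceq_{\sf univ}$ on $Q_k\times Q_k$: $\langle s,o\rangle\preceq_{\sf univ}\langle s',o'\rangle$ iff for all $(\ell,n)\in s$ there is $n'\le n$ with $(\ell,n')\in s'$; for all $(\ell,n)\in o$ there is $n'\le n$ with $(\ell,n')\in o'$; and $o=\emptyset$ iff $o'=\emptyset$. A pre-order $\preceq$ on the states of an NBW with transition function $\delta'$ and accepting set $\alpha'$ is a simulation if (1) whenever $x_3\preceq x_1$ and $x_2\in\delta'(x_1,\sigma)$, there is $x_4\preceq x_2$ with $x_4\in\delta'(x_3,\sigma)$; and (2) for all $x\in\alpha'$, every $x'\preceq x$ lies in $\alpha'$. -}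

module Defs where

open import Data.Nat using (ℕ; suc; _*_; _∸_)
open import Data.Fin using (Fin; toℕ) renaming (_≤_ to _≤ᶠ_)
open import Data.Fin.Subset using (Subset; _∈_; ∣_∣)
open import Data.Bool using (Bool; true; false)
open import Data.Product using (Σ; ∃; ∃-syntax; _×_; _,_; proj₁)
open import Data.Sum using (_⊎_)
open import Relation.Nullary using (¬_)
open import Relation.Binary.PropositionalEquality using (_≡_)
open import Function.Bundles using (_⇔_)
open import Data.Bool using (_∧_)
open import Data.Bool.Properties using (∧-zeroʳ)
open import Data.Fin using (_≟_; fromℕ)
open import Data.Fin.Properties using (toℕ-fromℕ)
open import Data.Nat.Properties using (even≢odd)
open import Relation.Nullary using (does; yes; no)
open import Relation.Binary.PropositionalEquality using (refl; sym; cong) renaming (trans to ≡-trans)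

record NBW (nQ nΣ : ℕ) : Set where
  field
    ι : Fin nQ
    δ : Fin nQ → Fin nΣ → Subset nQ
    α : Subset nQ

IsOdd : ℕ → Set
IsOdd n = ∃[ m ] n ≡ suc (2 * m)

record NBWg (St : Set) (nΣ : ℕ) : Set₁ where
  field
    init : St
    trans : St → Fin nΣ → St → Set
    acc   : St → Set

IsSimulation : ∀ {St : Set} {nΣ : ℕ} → NBWg St nΣ → (St → St → Set) → Set
IsSimulation {St} {nΣ} B _≼_ =
  (∀ (x₁ x₂ x₃ : St) (σ : Fin nΣ) → x₃ ≼ x₁ → NBWg.trans B x₁ σ x₂ →
     ∃[ x₄ ] (x₄ ≼ x₂ × NBWg.trans B x₃ σ x₄))
  × (∀ (x x' : St) → NBWg.acc B x → x' ≼ x → NBWg.acc B x')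

module KVMH {nQ nΣ : ℕ} (A : NBW nQ nΣ) where
  open NBW A

  k : ℕ
  k = 2 * (nQ ∸ ∣ α ∣)

  Rank : Set
  Rank = Fin (suc k)

  RawSet : Set
  RawSet = Fin nQ → Rank → Bool

  _∋_,_ : RawSet → Fin nQ → Rank → Set
  s ∋ ℓ , n = s ℓ n ≡ true

  WF : RawSet → Set
  WF s = ∀ ℓ n → s ∋ ℓ , n → ℓ ∈ α → ¬ IsOdd (toℕ n)

  Qk : Set
  Qk = Σ RawSet WF

  IsEmpty : RawSet → Set
  IsEmpty s = ∀ ℓ n → s ℓ n ≡ false

  _⊆ᵣ_ : RawSet → RawSet → Set
  s ⊆ᵣ s' = ∀ ℓ n → s ∋ ℓ , n → s' ∋ ℓ , n

  IsMinusOdd : RawSet → RawSet → Set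
  IsMinusOdd t s = ∀ ℓ n → (t ∋ ℓ , n) ⇔ ((s ∋ ℓ , n) × ¬ IsOdd (toℕ n))

  Covers : Fin nΣ → RawSet → RawSet → Set
  Covers σ s s' = ∀ ℓ n → s ∋ ℓ , n → ∀ ℓ' → ℓ' ∈ δ ℓ σ →
                  ∃[ n' ] (n' ≤ᶠ n × s' ∋ ℓ' , n')

  State : Set
  State = Qk × Qk

  Trans : State → Fin nΣ → State → Set
  Trans ((s , _) , (o , _)) σ ((s₂ , _) , (o₂ , _)) =
      (¬ IsEmpty o ×
        ∃[ o' ] (WF o' × o' ⊆ᵣ s₂ × Covers σ s s₂ × Covers σ o o'
                 × IsMinusOdd o₂ o'))
    ⊎ (IsEmpty o × Covers σ s s₂ × IsMinusOdd o₂ s₂)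

  Acc : State → Set
  Acc (_ , (o , _)) = IsEmpty o

  initS : RawSet
  initS ℓ n = does (ℓ ≟ ι) ∧ does (n ≟ fromℕ k)

  private
    ∧-true-r : ∀ b {n m : Rank} → (b ∧ does (n ≟ m)) ≡ true → n ≡ m
    ∧-true-r true {n} {m} h with n ≟ m
    ... | yes e = e
    ∧-true-r false ()

  initS-wf : WF initS
  initS-wf ℓ n h _ (m , eq) =
    even≢odd (nQ ∸ ∣ α ∣) m (≡-trans (sym (≡-trans (cong toℕ (∧-true-r (does (ℓ ≟ ι)) {n} {fromℕ k} h)) (toℕ-fromℕ k))) eq)

  initState : State
  initState = (initS , initS-wf) , ((λ _ _ → false) , λ _ _ ())

  KVMH : NBWg State nΣ
  KVMH = record { init = initState ; trans = Trans ; acc = Acc }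

  Dominates : RawSet → RawSet → Set
  Dominates s s' = ∀ ℓ n → s ∋ ℓ , n → ∃[ n' ] (n' ≤ᶠ n × s' ∋ ℓ , n')

  _≼univ_ : State → State → Set
  ((s , _) , (o , _)) ≼univ ((s' , _) , (o' , _)) =
    Dominates s s' × Dominates o o' × (IsEmpty o ⇔ IsEmpty o')

module Submission where

-- For the simulation property the key observation is that every
-- constraint on a successor ⟨s₂ , o₂⟩ of ⟨s , o⟩ only asks the successor
-- to cover s and o, and covering is antitone in the source: whatever
-- covers t also covers every s dominated by t.  Since x₃ ≼univ x₁ also
-- fixes which of the two cases (o empty or not) of the transition
-- relation applies, every successor x₂ of x₁ is already a successor of
-- x₃, so x₄ = x₂ witnesses the simulation step.  Acceptance (o = ∅) is
-- preserved downwards because ≼univ respects emptiness of o.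

open import Defs
open import Data.Nat using (ℕ)
open import Data.Product using (_×_; _,_)
open import Data.Sum using (inj₁; inj₂)
open import Relation.Binary.PropositionalEquality using (_≡_; refl; isEquivalence)
open import Relation.Binary.Structures using (IsPreorder)
open import Function.Bundles using (Equivalence)
import Function.Properties.Equivalence as ⇔
import Data.Fin.Properties as Fin

module KVMHSimulation {nQ nΣ : ℕ} (A : NBW nQ nΣ) where
  open KVMH A

  dominates-refl : ∀ s → Dominates s s
  dominates-refl s ℓ n s∋ℓn = n , Fin.≤-refl , s∋ℓn

  dominates-trans : ∀ s t u → Dominates s t → Dominates t u → Dominates s u
  dominates-trans s t u s≼t t≼u ℓ n s∋ℓn with s≼t ℓ n s∋ℓn
  ... | m , m≤n , t∋ℓm with t≼u ℓ m t∋ℓm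
  ... | m' , m'≤m , u∋ℓm' = m' , Fin.≤-trans m'≤m m≤n , u∋ℓm'

  covers-antitone : ∀ σ s t u → Dominates s t → Covers σ t u → Covers σ s u
  covers-antitone σ s t u s≼t t⇝u ℓ n s∋ℓn ℓ' ℓ'∈δ with s≼t ℓ n s∋ℓn
  ... | m , m≤n , t∋ℓm with t⇝u ℓ m t∋ℓm ℓ' ℓ'∈δ
  ... | m' , m'≤m , u∋ℓ'm' = m' , Fin.≤-trans m'≤m m≤n , u∋ℓ'm'

  ≼univ-refl : ∀ x → x ≼univ x
  ≼univ-refl ((s , _) , (o , _)) = dominates-refl s , dominates-refl o , ⇔.refl

  ≼univ-trans : ∀ x y z → x ≼univ y → y ≼univ z → x ≼univ z
  ≼univ-trans ((s , _) , (o , _)) ((s' , _) , (o' , _)) ((s'' , _) , (o'' , _))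
    (s≼s' , o≼o' , ∅⇔∅') (s'≼s'' , o'≼o'' , ∅'⇔∅'') =
    dominates-trans s s' s'' s≼s' s'≼s'' ,
    dominates-trans o o' o'' o≼o' o'≼o'' ,
    ⇔.trans ∅⇔∅' ∅'⇔∅''

  ≼univ-isPreorder : IsPreorder _≡_ _≼univ_
  ≼univ-isPreorder = record
    { isEquivalence = isEquivalence
    ; reflexive     = λ { {x} refl → ≼univ-refl x }
    ; trans         = λ {x} {y} {z} → ≼univ-trans x y z
    }

  trans-downward-closed : ∀ x₁ x₃ σ x₂ → x₃ ≼univ x₁ → Trans x₁ σ x₂ → Trans x₃ σ x₂
  trans-downward-closed ((s₁ , _) , (o₁ , _)) ((s₃ , _) , (o₃ , _)) σ _
    (s₃≼s₁ , o₃≼o₁ , ∅₃⇔∅₁) (inj₁ (o₁≢∅ , o' , wf , o'⊆s₂ , s₁⇝s₂ , o₁⇝o' , o₂=o'∖odd)) =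
    inj₁ ( (λ o₃=∅ → o₁≢∅ (Equivalence.to ∅₃⇔∅₁ o₃=∅))
         , o' , wf , o'⊆s₂
         , covers-antitone σ s₃ s₁ _ s₃≼s₁ s₁⇝s₂
         , covers-antitone σ o₃ o₁ o' o₃≼o₁ o₁⇝o'
         , o₂=o'∖odd )
  trans-downward-closed ((s₁ , _) , _) ((s₃ , _) , _) σ _
    (s₃≼s₁ , _ , ∅₃⇔∅₁) (inj₂ (o₁=∅ , s₁⇝s₂ , o₂=s₂∖odd)) =
    inj₂ ( Equivalence.from ∅₃⇔∅₁ o₁=∅
         , covers-antitone σ s₃ s₁ _ s₃≼s₁ s₁⇝s₂
         , o₂=s₂∖odd )

  acc-downward-closed : ∀ x x' → Acc x → x' ≼univ x → Acc x'
  acc-downward-closed _ _ x-acc (_ , _ , ∅'⇔∅) = Equivalence.from ∅'⇔∅ x-acc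

  ≼univ-isSimulation : IsSimulation KVMH _≼univ_
  ≼univ-isSimulation =
    (λ x₁ x₂ x₃ σ x₃≼x₁ x₁→x₂ →
       x₂ , ≼univ-refl x₂ , trans-downward-closed x₁ x₃ σ x₂ x₃≼x₁ x₁→x₂)
    , acc-downward-closed

lemma5p2 : ∀ {nQ nΣ : ℕ} (A : NBW nQ nΣ) →
    IsPreorder _≡_ (KVMH._≼univ_ A) × IsSimulation (KVMH.KVMH A) (KVMH._≼univ_ A)
lemma5p2 A = ≼univ-isPreorder , ≼univ-isSimulation
  where open KVMHSimulation A
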